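{- Let $A$ be a set, $x\notin A$, and let $\rho:A\to S_\infty$ induce a cofinitary representation. Let $s$ be a finite partial injection from $\omega$ to $\omega$ and $W_0$ a finite set of nice words (with respect to $\rho$). Then: (1) if $n\in\omega\setminus\mathrm{dom}(s)$, then for all but finitely many $m\in\omega$, $t:=s\cup\{(n,m)\}$ is a finite partial injection and $\mathrm{fix}(\rho[s](w))=\mathrm{fix}(\rho[t](w))$ for every $w\in W_0$; (2) if $m\in\omega\setminus\mathrm{ran}(s)$, then for all but finitely many $n\in\omega$, $t:=s\cup\{(n,m)\}$ is a finite partial injection and $\mathrm{fix}(\rho[s](w))=\mathrm{fix}(\rho[t](w))$ for every $w\in W_0$.
   Context: $S_\infty$ is the group of permutations of $\omega$; finite partial injections $\omega\rightharpoonup\omega$ together with $S_\infty$ form a monoid under composition of partial functions, and each partial injection $g$ has partial inverse $g^{ -1}$. For a partial injection $g$, $\mathrm{fix}(g)=\{n\in\mathrm{dom}(g): g(n)=n\}$. $W_B$ denotes the free group on $B$ (reduced words in $B\cup B^{ -1}$). A map $\sigma:B\to S_\infty$ induces a cofinitary representation iff every value of the induced homomorphism $W_B\to S_\infty$ is the identity or has finitely many fixed points; write $\rho(w)$ for the value of the induced homomorphism at $w\in W_A$. For a partial injection $g$, $\rho[g]$ is the map on letters $a\mapsto\rho(a)$, $a^{ -1}\mapsto\rho(a)^{ -1}$ ($a\in A$), $x\mapsto g$, $x^{ -1}\mapsto g^{ -1}$, extended to words in $A\cup\{x\}$ by composition (the word $y_{k-1}\cdots y_0$ is sent to the composition $\rho[g](y_{k-1})\circ\cdots\circ\rho[g](y_0)$).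 Let $W^0=W_A\setminus\ker\rho$. For $n>0$, $W^n$ is the set of reduced words $w\in W_{A\cup\{x\}}$ which are $x^n$ or $x^{ -n}$ or of the form $u_lx^{k_l}u_{l-1}x^{k_{l-1}}\cdots u_1x^{k_1}u_0x^{k_0}$ with $l<\omega$, $u_i\in W^0$, $k_i\in\mathbb Z\setminus\{0\}$, $\sum_{i\le l}|k_i|=n$. Nice words are the elements of $\bigcup_{n>0}W^n$. -}

module Defs where

open import Data.Nat using (ℕ; suc; _>_)
open import Data.Integer using (ℤ; +_; -[1+_]; ∣_∣)
open import Data.List using (List; []; _∷_; _++_; replicate; map; concatMap)
open import Data.Nat.ListAction using (sum)
open import Data.List.Membership.Propositional using (_∈_; _∉_)
open import Data.List.Relation.Unary.All using (All)
open import Data.Product using (_×_; _,_; proj₂; ∃-syntax)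
open import Data.Sum using (_⊎_)
open import Data.Unit using (⊤)
open import Function using (_∘_)
open import Function.Bundles using (_↔_; Inverse)
open import Relation.Nullary using (¬_)
open import Relation.Binary.PropositionalEquality using (_≡_; _≢_)

-- exponent sign of a letter: (a , pos) is a, (a , neg) is a⁻¹
data Sign : Set where
  pos neg : Sign

Perm : Set
Perm = ℕ ↔ ℕ

-- A word y_{k-1} ⋯ y_0 over the letters L ∪ L⁻¹ is the list
-- y_{k-1} ∷ ⋯ ∷ y_0 ∷ [] (head = leftmost letter, applied last).
Word : Set → Set
Word L = List (L × Sign)

Reduced : {L : Set} → Word L → Set
Reduced [] = ⊤
Reduced (_ ∷ []) = ⊤
Reduced ((a , e) ∷ (b , f) ∷ w) = ¬ (a ≡ b × e ≢ f) × Reduced ((b , f) ∷ w)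

applyA : {A : Set} → (A → Perm) → A × Sign → ℕ → ℕ
applyA ρ (a , pos) = Inverse.to (ρ a)
applyA ρ (a , neg) = Inverse.from (ρ a)

evalA : {A : Set} → (A → Perm) → Word A → ℕ → ℕ
evalA ρ [] n = n
evalA ρ (y ∷ w) n = applyA ρ y (evalA ρ w n)

IsCofinitaryRep : {A : Set} → (A → Perm) → Set
IsCofinitaryRep {A} ρ =
  (w : Word A) → Reduced w →
  (∀ n → evalA ρ w n ≡ n) ⊎ (∃[ F ] (∀ n → evalA ρ w n ≡ n → n ∈ F))

InW0 : {A : Set} → (A → Perm) → Word A → Set
InW0 ρ u = Reduced u × ¬ (∀ n → evalA ρ u n ≡ n)

-- Letters of A ∪ {x}, with x ∉ A (disjoint sum)

data LetterX (A : Set) : Set where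
  lA : A → LetterX A
  x  : LetterX A

PInj : Set
PInj = List (ℕ × ℕ)

IsPInj : PInj → Set
IsPInj g = ∀ {a b c d} → (a , b) ∈ g → (c , d) ∈ g → (a ≡ c → b ≡ d) × (b ≡ d → a ≡ c)

NotInDom : ℕ → PInj → Set
NotInDom n s = ∀ m → (n , m) ∉ s

NotInRan : ℕ → PInj → Set
NotInRan m s = ∀ n → (n , m) ∉ s

stepX : {A : Set} → (A → Perm) → PInj → LetterX A × Sign → ℕ → ℕ → Set
stepX ρ g (lA a , e) j k = applyA ρ (a , e) j ≡ k
stepX ρ g (x , pos) j k = (j , k) ∈ g
stepX ρ g (x , neg) j k = (k , j) ∈ g

-- ρ[g](w) as composition of partial maps: Maps ρ g w n k  iff  ρ[g](w)(n) = k
Maps : {A : Set} → (A → Perm) → PInj → Word (LetterX A) → ℕ → ℕ → Set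
Maps ρ g [] n k = n ≡ k
Maps ρ g (y ∷ w) n k = ∃[ j ] (Maps ρ g w n j × stepX ρ g y j k)

Fix : {A : Set} → (A → Perm) → PInj → Word (LetterX A) → ℕ → Set
Fix ρ g w n = Maps ρ g w n n

SameFix : {A : Set} → (A → Perm) → PInj → PInj → Word (LetterX A) → Set
SameFix ρ s t w = ∀ n → (Fix ρ s w n → Fix ρ t w n) × (Fix ρ t w n → Fix ρ s w n)

embed : {A : Set} → Word A → Word (LetterX A)
embed = map (λ { (a , e) → (lA a , e) })

xpow : {A : Set} → ℤ → Word (LetterX A)
xpow (+ n) = replicate n (x , pos)
xpow -[1+ n ] = replicate (suc n) (x , neg)

-- block list [(u_l , k_l) , … , (u_0 , k_0)] ↦ u_l x^{k_l} ⋯ u_0 x^{k_0}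
blocksWord : {A : Set} → List (Word A × ℤ) → Word (LetterX A)
blocksWord = concatMap (λ { (u , k) → embed u ++ xpow k })

-- shape condition of W^n (n > 0 is imposed in IsNice)
data InW {A : Set} (ρ : A → Perm) : ℕ → Word (LetterX A) → Set where
  xposW : ∀ n → InW ρ n (replicate n (x , pos))
  xnegW : ∀ n → InW ρ n (replicate n (x , neg))
  blocksW : ∀ n w (b : List (Word A × ℤ)) → b ≢ [] →
            All (λ { (u , k) → InW0 ρ u × k ≢ + 0 }) b →
            sum (map (∣_∣ ∘ proj₂) b) ≡ n →
            w ≡ blocksWord b →
            InW ρ n w

-- w ∈ W^n for some n > 0 (W^n consists of reduced words)
IsNice : {A : Set} → (A → Perm) → Word (LetterX A) → Set
IsNice ρ w = Reduced w × ∃[ n ] (n > 0 × InW ρ n w)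

-- Let t = s ∪ {(p , q)} where one endpoint f of the new edge is fresh, so that f is
-- an endpoint of exactly one edge of t.  Adding an edge can only create fixed points,
-- so the point is that a fixed point of ρ[t](w) never uses the new edge.  A run of
-- x-letters cannot pass through f, so a run that avoids f at both ends stays in s.
-- In a nice word every run x^k is followed by some u ∈ W⁰, and we choose f outside
-- the finitely many fixed points of u and outside u⁻¹(S) ∪ u(S), where S is the
-- finite set of vertices of s together with the other endpoint.  Then u never maps f
-- to a vertex of t or a vertex of t to f; this forces every block u x^k of a fixed
-- point computation to start and end away from f, so the whole computation lies in s.
module Submission where

open import Defs
open import Data.Nat using (ℕ; zero; suc)
open import Data.Integer using (ℤ; +_; -[1+_])
open import Data.List using (List; []; _∷_; _++_; replicate; map)
open import Data.List.Membership.Propositional using (_∈_; _∉_)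
open import Data.List.Membership.Propositional.Properties using (∈-map⁺; ∈-++⁺ˡ; ∈-++⁺ʳ)
open import Data.List.Relation.Binary.Subset.Propositional using (_⊆_)
open import Data.List.Relation.Unary.All using (All; []; _∷_)
open import Data.List.Relation.Unary.Any using (here; there)
open import Data.Product using (_×_; _,_; ∃-syntax; proj₁; proj₂)
open import Data.Sum using (_⊎_; inj₁; inj₂)
open import Data.Empty using (⊥; ⊥-elim)
open import Function using (id)
open import Function.Bundles using (Inverse)
open import Relation.Binary.PropositionalEquality using (_≡_; _≢_; refl; sym; subst)

vertices : PInj → List ℕ
vertices [] = []
vertices ((a , b) ∷ s) = a ∷ b ∷ vertices s

∈-vertices-dom : ∀ {a b} s → (a , b) ∈ s → a ∈ vertices s
∈-vertices-dom (_ ∷ s) (here refl) = here refl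
∈-vertices-dom (_ ∷ s) (there ab∈s) = there (there (∈-vertices-dom s ab∈s))

∈-vertices-ran : ∀ {a b} s → (a , b) ∈ s → b ∈ vertices s
∈-vertices-ran (_ ∷ s) (here refl) = there (here refl)
∈-vertices-ran (_ ∷ s) (there ab∈s) = there (there (∈-vertices-ran s ab∈s))

IsPInj-∷ : ∀ {n m s} → IsPInj s → NotInDom n s → NotInRan m s → IsPInj ((n , m) ∷ s)
IsPInj-∷ _ _ _ (here refl) (here refl) = (λ _ → refl) , (λ _ → refl)
IsPInj-∷ _ n∉dom m∉ran (here refl) (there cd∈s) =
  (λ { refl → ⊥-elim (n∉dom _ cd∈s) }) , (λ { refl → ⊥-elim (m∉ran _ cd∈s) })
IsPInj-∷ _ n∉dom m∉ran (there ab∈s) (here refl) =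
  (λ { refl → ⊥-elim (n∉dom _ ab∈s) }) , (λ { refl → ⊥-elim (m∉ran _ ab∈s) })
IsPInj-∷ s-inj _ _ (there ab∈s) (there cd∈s) = s-inj ab∈s cd∈s

module _ {A : Set} (ρ : A → Perm) where

  applyA⁻¹ : A × Sign → ℕ → ℕ
  applyA⁻¹ (a , pos) = Inverse.from (ρ a)
  applyA⁻¹ (a , neg) = Inverse.to (ρ a)

  evalA⁻¹ : Word A → ℕ → ℕ
  evalA⁻¹ [] n = n
  evalA⁻¹ (y ∷ w) n = evalA⁻¹ w (applyA⁻¹ y n)

  applyA⁻¹-applyA : ∀ y n → applyA⁻¹ y (applyA ρ y n) ≡ n
  applyA⁻¹-applyA (a , pos) n = Inverse.inverseʳ (ρ a) refl
  applyA⁻¹-applyA (a , neg) n = Inverse.inverseˡ (ρ a) refl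

  evalA⁻¹-evalA : ∀ w n → evalA⁻¹ w (evalA ρ w n) ≡ n
  evalA⁻¹-evalA [] n = refl
  evalA⁻¹-evalA (y ∷ w) n rewrite applyA⁻¹-applyA y (evalA ρ w n) = evalA⁻¹-evalA w n

  fixedPoints-finite : IsCofinitaryRep ρ → (u : Word A) → InW0 ρ u →
                       ∃[ F ] (∀ n → evalA ρ u n ≡ n → n ∈ F)
  fixedPoints-finite cof u (u-red , u≢id) with cof u u-red
  ... | inj₁ u≡id = ⊥-elim (u≢id u≡id)
  ... | inj₂ finite = finite

  Avoids : Word A → ℕ → List ℕ → Set
  Avoids u f V = evalA ρ u f ∉ V × (∀ {y} → y ∈ V → evalA ρ u y ≢ f)

  Avoids-⊆ : ∀ {u f V V′} → V ⊆ V′ → Avoids u f V′ → Avoids u f V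
  Avoids-⊆ V⊆V′ (uf∉V′ , u↛f) = (λ uf∈V → uf∉V′ (V⊆V′ uf∈V)) , (λ y∈V → u↛f (V⊆V′ y∈V))

  Maps-++⁻ : ∀ {g} (w₁ w₂ : Word (LetterX A)) {a c} → Maps ρ g (w₁ ++ w₂) a c →
             ∃[ j ] (Maps ρ g w₂ a j × Maps ρ g w₁ j c)
  Maps-++⁻ [] w₂ a↦c = _ , a↦c , refl
  Maps-++⁻ (y ∷ w₁) w₂ (i , a↦i , i↦c) with Maps-++⁻ w₁ w₂ a↦i
  ... | j , a↦j , j↦i = j , a↦j , (i , j↦i , i↦c)

  Maps-++⁺ : ∀ {g} (w₁ w₂ : Word (LetterX A)) {a j c} →
             Maps ρ g w₂ a j → Maps ρ g w₁ j c → Maps ρ g (w₁ ++ w₂) a c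
  Maps-++⁺ [] w₂ a↦j refl = a↦j
  Maps-++⁺ (y ∷ w₁) w₂ a↦j (i , j↦i , i↦c) = i , Maps-++⁺ w₁ w₂ a↦j j↦i , i↦c

  Maps-embed⁻ : ∀ {g} (u : Word A) {a c} → Maps ρ g (embed u) a c → evalA ρ u a ≡ c
  Maps-embed⁻ [] a≡c = a≡c
  Maps-embed⁻ (_ ∷ u) (j , a↦j , j↦c) rewrite Maps-embed⁻ u a↦j = j↦c

  Maps-embed⁺ : ∀ {g} (u : Word A) {a c} → evalA ρ u a ≡ c → Maps ρ g (embed u) a c
  Maps-embed⁺ [] ua≡c = ua≡c
  Maps-embed⁺ (_ ∷ u) ua≡c = _ , Maps-embed⁺ u refl , ua≡c

  Maps-mono : ∀ {g h} → g ⊆ h → ∀ w {a c} → Maps ρ g w a c → Maps ρ h w a c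
  Maps-mono g⊆h [] a≡c = a≡c
  Maps-mono g⊆h ((lA _ , _) ∷ w) (j , a↦j , j↦c) = j , Maps-mono g⊆h w a↦j , j↦c
  Maps-mono g⊆h ((x , pos) ∷ w) (j , a↦j , j↦c) = j , Maps-mono g⊆h w a↦j , g⊆h j↦c
  Maps-mono g⊆h ((x , neg) ∷ w) (j , a↦j , c↦j) = j , Maps-mono g⊆h w a↦j , g⊆h c↦j

module Exceptions {A : Set} (ρ : A → Perm) (cof : IsCofinitaryRep ρ) (S : List ℕ) where

  exceptionsW0 : (u : Word A) → InW0 ρ u → List ℕ
  exceptionsW0 u u∈W⁰ =
    proj₁ (fixedPoints-finite ρ cof u u∈W⁰) ++ map (evalA⁻¹ ρ u) S ++ map (evalA ρ u) S

  avoids-∉exceptionsW0 : ∀ {f} u (u∈W⁰ : InW0 ρ u) → f ∉ exceptionsW0 u u∈W⁰ → Avoids ρ u f (f ∷ S)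
  avoids-∉exceptionsW0 {f} u u∈W⁰ f∉E = uf∉ , u↛f
    where
    F : List ℕ
    F = proj₁ (fixedPoints-finite ρ cof u u∈W⁰)

    not-fixed : evalA ρ u f ≢ f
    not-fixed uf≡f = f∉E (∈-++⁺ˡ (proj₂ (fixedPoints-finite ρ cof u u∈W⁰) f uf≡f))

    uf∉ : evalA ρ u f ∉ f ∷ S
    uf∉ (here uf≡f) = not-fixed uf≡f
    uf∉ (there uf∈S) = f∉E (∈-++⁺ʳ F (∈-++⁺ˡ
      (subst (_∈ map (evalA⁻¹ ρ u) S) (evalA⁻¹-evalA ρ u f) (∈-map⁺ (evalA⁻¹ ρ u) uf∈S))))

    u↛f : ∀ {y} → y ∈ f ∷ S → evalA ρ u y ≢ f
    u↛f (here refl) = not-fixed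
    u↛f (there y∈S) uy≡f = f∉E (∈-++⁺ʳ F (∈-++⁺ʳ (map (evalA⁻¹ ρ u) S)
      (subst (_∈ map (evalA ρ u) S) uy≡f (∈-map⁺ (evalA ρ u) y∈S))))

  InBlock : Word A × ℤ → Set
  InBlock (u , k) = InW0 ρ u × k ≢ + 0

  exceptionsBlocks : (b : List (Word A × ℤ)) → All InBlock b → List ℕ
  exceptionsBlocks [] [] = []
  exceptionsBlocks ((u , _) ∷ b) ((u∈W⁰ , _) ∷ b-ok) = exceptionsW0 u u∈W⁰ ++ exceptionsBlocks b b-ok

  exceptionsNice : ∀ {w} → IsNice ρ w → List ℕ
  exceptionsNice (_ , _ , _ , xposW _) = []
  exceptionsNice (_ , _ , _ , xnegW _) = []
  exceptionsNice (_ , _ , _ , blocksW _ _ b _ b-ok _ _) = exceptionsBlocks b b-ok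

  exceptions : ∀ {W} → All (IsNice ρ) W → List ℕ
  exceptions [] = []
  exceptions (w-nice ∷ W-nice) = exceptionsNice w-nice ++ exceptions W-nice

module LeafExtension {A : Set} (ρ : A → Perm) {s t : PInj} {f : ℕ} (s⊆t : s ⊆ t)
  (restrict : ∀ {a b} → (a , b) ∈ t → a ≢ f → b ≢ f → (a , b) ∈ s)
  (not-inner : ∀ {i j} → (i , f) ∈ t → (f , j) ∈ t → ⊥) where

  V : List ℕ
  V = vertices t

  step : Sign → ℕ → ℕ → Set
  step e = stepX ρ t (x , e)

  run : Sign → ℕ → Word (LetterX A)
  run e r = replicate r (x , e)

  step-vertices : ∀ e {i j} → step e i j → i ∈ V × j ∈ V
  step-vertices pos ij∈t = ∈-vertices-dom t ij∈t , ∈-vertices-ran t ij∈t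
  step-vertices neg ji∈t = ∈-vertices-ran t ji∈t , ∈-vertices-dom t ji∈t

  step-restrict : ∀ e {i j} → step e i j → i ≢ f → j ≢ f → stepX ρ s (x , e) i j
  step-restrict pos ij∈t i≢f j≢f = restrict ij∈t i≢f j≢f
  step-restrict neg ji∈t i≢f j≢f = restrict ji∈t j≢f i≢f

  step-not-through : ∀ e {i j} → step e i f → step e f j → ⊥
  step-not-through pos = not-inner
  step-not-through neg fi∈t jf∈t = not-inner jf∈t fi∈t

  run-source-∈V : ∀ e r {a c} → Maps ρ t (run e (suc r)) a c → a ∈ V
  run-source-∈V e zero (_ , refl , a↦c) = proj₁ (step-vertices e a↦c)
  run-source-∈V e (suc r) (_ , a↦j , _) = run-source-∈V e r a↦j

  run-departs : ∀ e r {a j c} → Maps ρ t (run e r) a j → step e j c → ∃[ i ] step e a i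
  run-departs e zero refl a↦c = _ , a↦c
  run-departs e (suc r) (_ , a↦i , i↦j) _ = run-departs e r a↦i i↦j

  run-inner-≢f : ∀ e r {a j c} → Maps ρ t (run e r) a j → step e j c → a ≢ f → j ≢ f
  run-inner-≢f e zero refl _ a≢f = a≢f
  run-inner-≢f e (suc r) (_ , _ , i↦f) f↦c _ refl = step-not-through e i↦f f↦c

  run-restrict : ∀ e r {a c} → Maps ρ t (run e r) a c → a ≢ f → c ≢ f → Maps ρ s (run e r) a c
  run-restrict e zero a≡c _ _ = a≡c
  run-restrict e (suc r) (j , a↦j , j↦c) a≢f c≢f =
    j , run-restrict e r a↦j a≢f j≢f , step-restrict e j↦c j≢f c≢f
    where
    j≢f : j ≢ f
    j≢f = run-inner-≢f e r a↦j j↦c a≢f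

  run-fix-≢f : ∀ e r {a} → Fix ρ t (run e (suc r)) a → a ≢ f
  run-fix-≢f e r (j , a↦j , j↦a) refl = step-not-through e j↦a (proj₂ (run-departs e r a↦j j↦a))

  xpow-endpoints : ∀ k {a c} → k ≢ + 0 → Maps ρ t (xpow k) a c → a ∈ V × c ∈ V
  xpow-endpoints (+ zero) k≢0 _ = ⊥-elim (k≢0 refl)
  xpow-endpoints (+ suc r) _ a↦c@(_ , _ , j↦c) =
    run-source-∈V pos r a↦c , proj₂ (step-vertices pos j↦c)
  xpow-endpoints -[1+ r ] _ a↦c@(_ , _ , j↦c) =
    run-source-∈V neg r a↦c , proj₂ (step-vertices neg j↦c)

  xpow-restrict : ∀ k {a c} → Maps ρ t (xpow k) a c → a ≢ f → c ≢ f → Maps ρ s (xpow k) a c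
  xpow-restrict (+ r) = run-restrict pos r
  xpow-restrict -[1+ r ] = run-restrict neg (suc r)

  xpow-fix-≢f : ∀ k {a} → k ≢ + 0 → Fix ρ t (xpow k) a → a ≢ f
  xpow-fix-≢f (+ zero) k≢0 _ = ⊥-elim (k≢0 refl)
  xpow-fix-≢f (+ suc r) _ = run-fix-≢f pos r
  xpow-fix-≢f -[1+ r ] _ = run-fix-≢f neg r

  sameFix-xpow : ∀ k → k ≢ + 0 → SameFix ρ s t (xpow k)
  sameFix-xpow k k≢0 a =
    Maps-mono ρ s⊆t (xpow k) , λ a↦a → xpow-restrict k a↦a (xpow-fix-≢f k k≢0 a↦a) (xpow-fix-≢f k k≢0 a↦a)

  Good : Word A × ℤ → Set
  Good (u , k) = Avoids ρ u f V × k ≢ + 0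

  block : Word A × ℤ → Word (LetterX A)
  block (u , k) = embed u ++ xpow k

  block-split : ∀ u k {a c} → Maps ρ t (block (u , k)) a c →
                ∃[ r ] (Maps ρ t (xpow k) a r × evalA ρ u r ≡ c)
  block-split u k a↦c with Maps-++⁻ ρ (embed u) (xpow k) a↦c
  ... | r , a↦r , r↦c = r , a↦r , Maps-embed⁻ ρ u r↦c

  block-source-∈V : ∀ {B a c} → Good B → Maps ρ t (block B) a c → a ∈ V
  block-source-∈V {u , k} (_ , k≢0) a↦c with block-split u k a↦c
  ... | _ , a↦r , _ = proj₁ (xpow-endpoints k k≢0 a↦r)

  block-target-≢f : ∀ {B a c} → Good B → Maps ρ t (block B) a c → c ≢ f
  block-target-≢f {u , k} ((_ , u↛f) , k≢0) a↦c c≡f with block-split u k a↦c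
  ... | _ , a↦r , ur≡c = u↛f (proj₂ (xpow-endpoints k k≢0 a↦r)) (subst (evalA ρ u _ ≡_) c≡f ur≡c)

  block-restrict : ∀ {B a c} → Good B → Maps ρ t (block B) a c → a ≢ f → c ∈ V → Maps ρ s (block B) a c
  block-restrict {u , k} ((uf∉V , _) , _) a↦c a≢f c∈V with block-split u k a↦c
  ... | r , a↦r , ur≡c =
    Maps-++⁺ ρ (embed u) (xpow k) (xpow-restrict k a↦r a≢f r≢f) (Maps-embed⁺ ρ u ur≡c)
    where
    -- if the run ended at f, the block would end at u f ∉ V
    r≢f : r ≢ f
    r≢f refl = uf∉V (subst (_∈ V) (sym ur≡c) c∈V)

  blocks-split : ∀ B b {a c} → Maps ρ t (blocksWord (B ∷ b)) a c →
                 ∃[ j ] (Maps ρ t (blocksWord b) a j × Maps ρ t (block B) j c)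
  blocks-split B b = Maps-++⁻ ρ (block B) (blocksWord b)

  blocks-source-∈V : ∀ B b {a c} → All Good (B ∷ b) → Maps ρ t (blocksWord (B ∷ b)) a c → a ∈ V
  blocks-source-∈V B [] (B-good ∷ _) a↦c with blocks-split B [] a↦c
  ... | _ , refl , a↦c′ = block-source-∈V B-good a↦c′
  blocks-source-∈V B (B′ ∷ b) (_ ∷ b-good) a↦c =
    blocks-source-∈V B′ b b-good (proj₁ (proj₂ (blocks-split B (B′ ∷ b) a↦c)))

  blocks-target-≢f : ∀ b {a c} → All Good b → Maps ρ t (blocksWord b) a c → a ≢ f → c ≢ f
  blocks-target-≢f [] [] refl a≢f = a≢f
  blocks-target-≢f (B ∷ b) (B-good ∷ _) a↦c _ = block-target-≢f B-good (proj₂ (proj₂ (blocks-split B b a↦c)))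

  blocks-restrict : ∀ b {a c} → All Good b → Maps ρ t (blocksWord b) a c → a ≢ f → c ∈ V →
                    Maps ρ s (blocksWord b) a c
  blocks-restrict [] [] a≡c _ _ = a≡c
  blocks-restrict (B ∷ b) (B-good ∷ b-good) a↦c a≢f c∈V with blocks-split B b a↦c
  ... | j , a↦j , j↦c =
    Maps-++⁺ ρ (block B) (blocksWord b)
      (blocks-restrict b b-good a↦j a≢f (block-source-∈V B-good j↦c))
      (block-restrict B-good j↦c (blocks-target-≢f b b-good a↦j a≢f) c∈V)

  sameFix-blocks : ∀ b → b ≢ [] → All Good b → SameFix ρ s t (blocksWord b)
  sameFix-blocks [] b≢[] _ _ = ⊥-elim (b≢[] refl)
  sameFix-blocks (B ∷ b) _ b-good@(B-good ∷ _) a =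
    Maps-mono ρ s⊆t (blocksWord (B ∷ b)) ,
    λ a↦a → blocks-restrict (B ∷ b) b-good a↦a (a≢f a↦a) (blocks-source-∈V B b b-good a↦a)
    where
    a≢f : Fix ρ t (blocksWord (B ∷ b)) a → a ≢ f
    a≢f a↦a = block-target-≢f B-good (proj₂ (proj₂ (blocks-split B b a↦a)))

  module _ (cof : IsCofinitaryRep ρ) (S : List ℕ) (V⊆fS : V ⊆ f ∷ S) where
    open Exceptions ρ cof S

    good-∉exceptionsBlocks : ∀ b (b-ok : All InBlock b) → f ∉ exceptionsBlocks b b-ok → All Good b
    good-∉exceptionsBlocks [] [] _ = []
    good-∉exceptionsBlocks ((u , _) ∷ b) ((u∈W⁰ , k≢0) ∷ b-ok) f∉E =
      (Avoids-⊆ ρ {u = u} V⊆fS (avoids-∉exceptionsW0 {f} u u∈W⁰ (λ f∈ → f∉E (∈-++⁺ˡ f∈))) , k≢0)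
      ∷ good-∉exceptionsBlocks b b-ok (λ f∈ → f∉E (∈-++⁺ʳ (exceptionsW0 u u∈W⁰) f∈))

    sameFix-nice : ∀ {w} (w-nice : IsNice ρ w) → f ∉ exceptionsNice w-nice → SameFix ρ s t w
    sameFix-nice (_ , zero , () , _)
    sameFix-nice (_ , suc r , _ , xposW _) _ = sameFix-xpow (+ suc r) (λ ())
    sameFix-nice (_ , suc r , _ , xnegW _) _ = sameFix-xpow -[1+ r ] (λ ())
    sameFix-nice (_ , _ , _ , blocksW _ _ b b≢[] b-ok _ refl) f∉E =
      sameFix-blocks b b≢[] (good-∉exceptionsBlocks b b-ok f∉E)

    sameFix-∉exceptions : ∀ {W} (W-nice : All (IsNice ρ) W) → f ∉ exceptions W-nice → All (SameFix ρ s t) W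
    sameFix-∉exceptions [] _ = []
    sameFix-∉exceptions (w-nice ∷ W-nice) f∉E =
      sameFix-nice w-nice (λ f∈ → f∉E (∈-++⁺ˡ f∈))
      ∷ sameFix-∉exceptions W-nice (λ f∈ → f∉E (∈-++⁺ʳ (exceptionsNice w-nice) f∈))

∷-restrict : ∀ {s : PInj} {p q f a b : ℕ} → f ≡ p ⊎ f ≡ q → (a , b) ∈ (p , q) ∷ s → a ≢ f → b ≢ f → (a , b) ∈ s
∷-restrict (inj₁ refl) (here refl) a≢f _ = ⊥-elim (a≢f refl)
∷-restrict (inj₂ refl) (here refl) _ b≢f = ⊥-elim (b≢f refl)
∷-restrict _ (there ab∈s) _ _ = ab∈s

∷-not-inner : ∀ {s : PInj} {p q f i j : ℕ} → p ≢ q → f ∉ vertices s →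
              (i , f) ∈ (p , q) ∷ s → (f , j) ∈ (p , q) ∷ s → ⊥
∷-not-inner p≢q _ (here refl) (here refl) = p≢q refl
∷-not-inner {s} _ f∉s (here refl) (there fj∈s) = f∉s (∈-vertices-dom s fj∈s)
∷-not-inner {s} _ f∉s (there if∈s) _ = f∉s (∈-vertices-ran s if∈s)

module FreshExtension {A : Set} (ρ : A → Perm) (cof : IsCofinitaryRep ρ) (s : PInj)
  {W : List (Word (LetterX A))} (W-nice : All (IsNice ρ) W) where

  -- o is the endpoint of the new edge given in advance, f the one to be chosen.
  excluded : ℕ → List ℕ
  excluded o = o ∷ vertices s ++ Exceptions.exceptions ρ cof (o ∷ vertices s) W-nice

  ∉excluded⇒∉vertices : ∀ {o f} → f ∉ excluded o → f ∉ vertices s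
  ∉excluded⇒∉vertices f∉E f∈s = f∉E (there (∈-++⁺ˡ f∈s))

  ∉excluded⇒≢ : ∀ {o f} → f ∉ excluded o → f ≢ o
  ∉excluded⇒≢ f∉E f≡o = f∉E (here f≡o)

  sameFix-freshEdge : ∀ {o f p q} → p ≢ q → f ≡ p ⊎ f ≡ q → vertices ((p , q) ∷ s) ⊆ f ∷ o ∷ vertices s →
                      f ∉ excluded o → All (SameFix ρ s ((p , q) ∷ s)) W
  sameFix-freshEdge {o} p≢q f∈pq V⊆fS f∉E =
    LeafExtension.sameFix-∉exceptions ρ there (∷-restrict f∈pq) (∷-not-inner p≢q (∉excluded⇒∉vertices f∉E))
      cof (o ∷ vertices s) V⊆fS W-nice (λ f∈ → f∉E (there (∈-++⁺ʳ (vertices s) f∈)))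

  sameFix-extension : ∀ {o f p q} → (p , q) ≡ (o , f) ⊎ (p , q) ≡ (f , o) → f ∉ excluded o →
                      All (SameFix ρ s ((p , q) ∷ s)) W
  sameFix-extension (inj₁ refl) f∉E = sameFix-freshEdge (λ o≡f → ∉excluded⇒≢ f∉E (sym o≡f)) (inj₂ refl) swap f∉E
    where
    swap : ∀ {o f v} → v ∈ o ∷ f ∷ vertices s → v ∈ f ∷ o ∷ vertices s
    swap (here refl) = there (here refl)
    swap (there (here refl)) = here refl
    swap (there (there v∈s)) = there (there v∈s)
  sameFix-extension (inj₂ refl) f∉E = sameFix-freshEdge (∉excluded⇒≢ f∉E) (inj₁ refl) id f∉E

mainTheorem13 : {A : Set} (ρ : A → Perm) → IsCofinitaryRep ρ →
    (s : PInj) → IsPInj s →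
    (W₀ : List (Word (LetterX A))) → All (IsNice ρ) W₀ →
    ((n : ℕ) → NotInDom n s →
      ∃[ E ] ((m : ℕ) → m ∉ E →
        IsPInj ((n , m) ∷ s) × All (SameFix ρ s ((n , m) ∷ s)) W₀))
    ×
    ((m : ℕ) → NotInRan m s →
      ∃[ E ] ((n : ℕ) → n ∉ E →
        IsPInj ((n , m) ∷ s) × All (SameFix ρ s ((n , m) ∷ s)) W₀))
mainTheorem13 ρ cof s s-inj W₀ W₀-nice = extendDom , extendRan
  where
  open FreshExtension ρ cof s W₀-nice

  extendDom : ∀ n → NotInDom n s → ∃[ E ] (∀ m → m ∉ E →
                IsPInj ((n , m) ∷ s) × All (SameFix ρ s ((n , m) ∷ s)) W₀)
  extendDom n n∉dom = excluded n , λ m m∉E →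
    IsPInj-∷ s-inj n∉dom (λ k km∈s → ∉excluded⇒∉vertices m∉E (∈-vertices-ran s km∈s)) ,
    sameFix-extension (inj₁ refl) m∉E

  extendRan : ∀ m → NotInRan m s → ∃[ E ] (∀ n → n ∉ E →
                IsPInj ((n , m) ∷ s) × All (SameFix ρ s ((n , m) ∷ s)) W₀)
  extendRan m m∉ran = excluded m , λ n n∉E →
    IsPInj-∷ s-inj (λ k nk∈s → ∉excluded⇒∉vertices n∉E (∈-vertices-dom s nk∈s)) m∉ran ,
    sameFix-extension (inj₂ refl) n∉E
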